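{- Let $\mathbb{F}$ be a finite field and $n\ge 2$. Then the clique number of $C_{T_n(\mathbb{F})}$ satisfies $\omega(C_{T_n(\mathbb{F})})=|\mathbb{F}|$.
   Context: For a finite ring $R$ with identity, the unitary Cayley graph $C_R$ is the simple graph with vertex set $R$ in which distinct $x,y\in R$ are adjacent if and only if $x-y$ is a unit of $R$. $T_n(\mathbb{F})$ denotes the ring of all upper triangular $n\times n$ matrices over $\mathbb{F}$. The clique number $\omega(G)$ is the largest size of a complete subgraph of $G$. -}

module Defs where

open import Level using (Level; _⊔_)
open import Algebra.Bundles using (CommutativeRing)
open import Data.Nat using (ℕ; zero; suc; _≤_)
open import Data.Fin using (Fin; _<_) renaming (zero to fzero; suc to fsuc)
open import Data.Product using (Σ; ∃; _×_; _,_; proj₁)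
open import Relation.Nullary using (¬_)
open import Relation.Binary.PropositionalEquality using (_≡_)

record IsField {c ℓ : Level} (F : CommutativeRing c ℓ) : Set (c ⊔ ℓ) where
  open CommutativeRing F
  field
    1≉0     : ¬ (1# ≈ 0#)
    inverse : ∀ x → ¬ (x ≈ 0#) → ∃ λ y → x * y ≈ 1#

record HasCardinality {c ℓ : Level} (F : CommutativeRing c ℓ) (q : ℕ) : Set (c ⊔ ℓ) where
  open CommutativeRing F
  field
    enum       : Fin q → Carrier
    injective  : ∀ i j → enum i ≈ enum j → i ≡ j
    surjective : ∀ x → ∃ λ i → enum i ≈ x

module UpperTriangular {c ℓ : Level} (F : CommutativeRing c ℓ) where
  open CommutativeRing F

  sumF : ∀ {n} → (Fin n → Carrier) → Carrier
  sumF {zero}  f = 0#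
  sumF {suc n} f = f fzero + sumF (λ i → f (fsuc i))

  Mat : ℕ → Set c
  Mat n = Fin n → Fin n → Carrier

  T : ℕ → Set (c ⊔ ℓ)
  T n = Σ (Mat n) λ A → ∀ i j → j < i → A i j ≈ 0#

  entry : ∀ {n} → T n → Mat n
  entry = proj₁

  _-M_ : ∀ {n} → Mat n → Mat n → Mat n
  (A -M B) i j = A i j - B i j

  _*M_ : ∀ {n} → Mat n → Mat n → Mat n
  (A *M B) i j = sumF (λ k → A i k * B k j)

  idM : ∀ {n} → Mat n
  idM i j with i Data.Fin.≟ j
  ... | Relation.Nullary.yes _ = 1#
  ... | Relation.Nullary.no  _ = 0#

  _≈M_ : ∀ {n} → Mat n → Mat n → Set ℓ
  A ≈M B = ∀ i j → A i j ≈ B i j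

  IsUnitT : ∀ {n} → T n → Set (c ⊔ ℓ)
  IsUnitT {n} X = ∃ λ (Y : T n) → ((entry X *M entry Y) ≈M idM) × ((entry Y *M entry X) ≈M idM)

  -- the unitary Cayley graph C_{T_n(F)}: distinct x, y adjacent iff x - y is a unit
  -- (x - y is upper triangular since x and y are)
  _-T_ : ∀ {n} → T n → T n → Mat n
  X -T Y = entry X -M entry Y

  Adjacent : ∀ {n} → T n → T n → Set (c ⊔ ℓ)
  Adjacent {n} X Y = ¬ (entry X ≈M entry Y) × (Σ (T n) λ D → (entry D ≈M (X -T Y)) × IsUnitT D)

  record Clique (n k : ℕ) : Set (c ⊔ ℓ) where
    field
      vertex   : Fin k → T n
      distinct : ∀ i j → entry (vertex i) ≈M entry (vertex j) → i ≡ j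
      adjacent : ∀ i j → ¬ (i ≡ j) → Adjacent (vertex i) (vertex j)

  CliqueNumber≡ : ℕ → ℕ → Set (c ⊔ ℓ)
  CliqueNumber≡ n m = Clique n m × (∀ k → Clique n k → k ≤ m)

{-# OPTIONS --safe #-}

-- The scalar matrices a·I, one for each a ∈ F, form a clique: a·I − b·I = (a − b)·I is a
-- unit as soon as a ≠ b.  Conversely, for upper triangular E the (0,0) entry of D E is
-- D₀₀ E₀₀, so the (0,0) entry of a unit is invertible; hence adjacent vertices differ in
-- their (0,0) entry, and a clique injects into F.

module Submission where

open import Defs
open import Level using (Level)
open import Algebra.Bundles using (CommutativeRing)
open import Data.Nat using (ℕ; _≤_; zero; suc; s≤s; z≤n)
open import Data.Fin using (Fin; _≟_; punchIn) renaming (zero to fzero; suc to fsuc)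
open import Data.Fin.Properties using (punchInᵢ≢i; injective⇒≤; <-irrefl)
open import Data.Product using (∃; _,_; proj₁; proj₂)
open import Function using (_∘_)
open import Relation.Nullary using (¬_; yes; no; contradiction)
open import Relation.Nullary.Decidable using (decidable-stable)
open import Relation.Binary.PropositionalEquality as ≡ using (_≡_; _≢_)

module UnitaryCayleyClique {c ℓ : Level} (F : CommutativeRing c ℓ) where
  open CommutativeRing F
  open UpperTriangular F
  open import Algebra.Properties.Ring ring using (x∙y⁻¹≈ε⇒x≈y; x≈y⇒x∙y⁻¹≈ε; [y-z]x≈yx-zx)
  open import Algebra.Properties.CommutativeSemigroup *-commutativeSemigroup using (xy∙z≈y∙xz)
  open import Algebra.Properties.Semiring.Sum semiring using (sum; sum-cong-≋; sum-replicate-zero; sum-remove)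
  open import Relation.Binary.Reasoning.Setoid setoid

  sum-≈0 : ∀ {n} (f : Fin n → Carrier) → (∀ k → f k ≈ 0#) → sum f ≈ 0#
  sum-≈0 {n} f f≈0 = trans (sum-cong-≋ f≈0) (sum-replicate-zero n)

  sumF≡sum : ∀ {n} (f : Fin n → Carrier) → sumF f ≡ sum f
  sumF≡sum {zero}  f = ≡.refl
  sumF≡sum {suc n} f = ≡.cong (f fzero +_) (sumF≡sum (f ∘ fsuc))

  sumF-cong : ∀ {n} {f g : Fin n → Carrier} → (∀ k → f k ≈ g k) → sumF f ≈ sumF g
  sumF-cong {f = f} {g} f≈g = begin
    sumF f ≡⟨ sumF≡sum f ⟩
    sum f  ≈⟨ sum-cong-≋ f≈g ⟩
    sum g  ≡⟨ sumF≡sum g ⟨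
    sumF g ∎

  sumF-≈0 : ∀ {n} (f : Fin n → Carrier) → (∀ k → f k ≈ 0#) → sumF f ≈ 0#
  sumF-≈0 f f≈0 = trans (reflexive (sumF≡sum f)) (sum-≈0 f f≈0)

  idM-diag : ∀ {n} (r : Fin n) → idM r r ≈ 1#
  idM-diag r with r ≟ r
  ... | yes _  = refl
  ... | no r≢r = contradiction ≡.refl r≢r

  idM-offdiag : ∀ {n} {r s : Fin n} → r ≢ s → idM r s ≈ 0#
  idM-offdiag {r = r} {s} r≢s with r ≟ s
  ... | yes r≡s = contradiction r≡s r≢s
  ... | no _    = refl

  sumF-idM-* : ∀ {n} (r : Fin n) (f : Fin n → Carrier) → sumF (λ k → idM r k * f k) ≈ f r
  sumF-idM-* {suc n} r f = begin
    sumF t                     ≡⟨ sumF≡sum t ⟩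
    sum t                      ≈⟨ sum-remove t ⟩
    t r + sum (t ∘ punchIn r)  ≈⟨ +-cong (*-congʳ (idM-diag r)) (sum-≈0 _ offdiag≈0) ⟩
    1# * f r + 0#              ≈⟨ +-identityʳ _ ⟩
    1# * f r                   ≈⟨ *-identityˡ _ ⟩
    f r                        ∎
    where
    t : Fin (suc n) → Carrier
    t k = idM r k * f k
    offdiag≈0 : ∀ j → t (punchIn r j) ≈ 0#
    offdiag≈0 j = trans (*-congʳ (idM-offdiag (punchInᵢ≢i r j ∘ ≡.sym))) (zeroˡ _)

  *M-upper-entry₀₀ : ∀ {n} (D : Mat (suc n)) (E : T (suc n)) →
                     (D *M entry E) fzero fzero ≈ D fzero fzero * entry E fzero fzero
  *M-upper-entry₀₀ D (E , upper) =
    trans (+-congˡ (sumF-≈0 _ below≈0)) (+-identityʳ _)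
    where
    below≈0 : ∀ k → D fzero (fsuc k) * E (fsuc k) fzero ≈ 0#
    below≈0 k = trans (*-congˡ (upper (fsuc k) fzero (s≤s z≤n))) (zeroʳ _)

  unit⇒entry₀₀-invertible : ∀ {n} (D : T (suc n)) → IsUnitT D →
                            ∃ λ e → entry D fzero fzero * e ≈ 1#
  unit⇒entry₀₀-invertible {n} D (E , DE≈I , _) =
    entry E fzero fzero ,
    trans (sym (*M-upper-entry₀₀ (entry D) E)) (trans (DE≈I fzero fzero) (idM-diag {suc n} fzero))

  invertible⇒≉0 : ¬ (1# ≈ 0#) → ∀ {x y} → x * y ≈ 1# → ¬ (x ≈ 0#)
  invertible⇒≉0 1≉0 {x} {y} xy≈1 x≈0 = 1≉0 (begin
    1#     ≈⟨ xy≈1 ⟨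
    x * y  ≈⟨ *-congʳ x≈0 ⟩
    0# * y ≈⟨ zeroˡ y ⟩
    0#     ∎)

  adjacent⇒entry₀₀-≉ : ¬ (1# ≈ 0#) → ∀ {n} {X Y : T (suc n)} → Adjacent X Y →
                       ¬ (entry X fzero fzero ≈ entry Y fzero fzero)
  adjacent⇒entry₀₀-≉ 1≉0 (_ , D , D≈X-Y , D-unit) X₀₀≈Y₀₀ =
    invertible⇒≉0 1≉0 (proj₂ (unit⇒entry₀₀-invertible D D-unit))
      (trans (D≈X-Y fzero fzero) (x≈y⇒x∙y⁻¹≈ε X₀₀≈Y₀₀))

  ≈-injective⇒≤ : ∀ {q} → HasCardinality F q → ∀ {k} (f : Fin k → Carrier) →
                  (∀ {i j} → f i ≈ f j → i ≡ j) → k ≤ q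
  ≈-injective⇒≤ card f f-injective = injective⇒≤ {f = index ∘ f} (f-injective ∘ index-injective)
    where
    open HasCardinality card
    index : Carrier → Fin _
    index x = proj₁ (surjective x)
    index-injective : ∀ {x y} → index x ≡ index y → x ≈ y
    index-injective {x} {y} eq = begin
      x              ≈⟨ proj₂ (surjective x) ⟨
      enum (index x) ≡⟨ ≡.cong enum eq ⟩
      enum (index y) ≈⟨ proj₂ (surjective y) ⟩
      y              ∎

  clique-size≤ : ¬ (1# ≈ 0#) → ∀ {q} → HasCardinality F q →
                 ∀ {n k} → Clique (suc n) k → k ≤ q
  clique-size≤ 1≉0 card {n} C =
    ≈-injective⇒≤ card (λ i → entry (vertex i) fzero fzero) entry₀₀-injective
    where
    open Clique C
    entry₀₀-injective : ∀ {i j} → entry (vertex i) fzero fzero ≈ entry (vertex j) fzero fzero → i ≡ j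
    entry₀₀-injective {i} {j} eq = decidable-stable (i ≟ j) λ i≢j →
      adjacent⇒entry₀₀-≉ 1≉0 {n} {vertex i} {vertex j} (adjacent i j i≢j) eq

  scalar : ∀ {n} → Carrier → T n
  scalar a = (λ r s → a * idM r s) ,
             λ r s s<r → trans (*-congˡ (idM-offdiag (λ r≡s → <-irrefl (≡.sym r≡s) s<r))) (zeroʳ a)

  scalar-diag : ∀ {n} a (r : Fin n) → entry (scalar a) r r ≈ a
  scalar-diag a r = trans (*-congˡ (idM-diag r)) (*-identityʳ a)

  scalar-injective : ∀ {n a b} → entry (scalar {suc n} a) ≈M entry (scalar b) → a ≈ b
  scalar-injective {n} {a} {b} eq =
    trans (sym (scalar-diag a (fzero {n}))) (trans (eq fzero fzero) (scalar-diag b (fzero {n})))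

  scalar-*M : ∀ {n} a b → (entry (scalar {n} a) *M entry (scalar b)) ≈M entry (scalar (a * b))
  scalar-*M a b r s = begin
    sumF (λ k → (a * idM r k) * (b * idM k s)) ≈⟨ sumF-cong (λ k → xy∙z≈y∙xz a (idM r k) (b * idM k s)) ⟩
    sumF (λ k → idM r k * (a * (b * idM k s))) ≈⟨ sumF-idM-* r (λ k → a * (b * idM k s)) ⟩
    a * (b * idM r s)                          ≈⟨ *-assoc a b (idM r s) ⟨
    (a * b) * idM r s                          ∎

  scalar-unit : ∀ {n a b} → a * b ≈ 1# → IsUnitT (scalar {n} a)
  scalar-unit {a = a} {b} ab≈1 = scalar b , inverse-of ab≈1 , inverse-of (trans (*-comm b a) ab≈1)
    where
    inverse-of : ∀ {x y} → x * y ≈ 1# → (entry (scalar x) *M entry (scalar y)) ≈M idM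
    inverse-of {x} {y} xy≈1 r s = trans (scalar-*M x y r s) (trans (*-congʳ xy≈1) (*-identityˡ (idM r s)))

  scalar-sub : ∀ {n} a b → entry (scalar {n} (a - b)) ≈M (scalar a -T scalar b)
  scalar-sub a b r s = [y-z]x≈yx-zx (idM r s) a b

  module _ (isField : IsField F) where
    open IsField isField

    scalar-adjacent : ∀ {n a b} → ¬ (a ≈ b) → Adjacent (scalar {suc n} a) (scalar b)
    scalar-adjacent {a = a} {b} a≉b =
      a≉b ∘ scalar-injective , scalar (a - b) , scalar-sub a b , scalar-unit (proj₂ a-b-invertible)
      where
      a-b-invertible : ∃ λ e → (a - b) * e ≈ 1#
      a-b-invertible = inverse (a - b) (a≉b ∘ x∙y⁻¹≈ε⇒x≈y a b)

    scalar-clique : ∀ {q} → HasCardinality F q → ∀ {n} → Clique (suc n) q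
    scalar-clique card = record
      { vertex   = scalar ∘ enum
      ; distinct = λ i j → injective i j ∘ scalar-injective
      ; adjacent = λ i j i≢j → scalar-adjacent (i≢j ∘ injective i j)
      }
      where open HasCardinality card

proposition4 : ∀ {c ℓ : Level} (F : CommutativeRing c ℓ) → IsField F →
                 ∀ (q : ℕ) → HasCardinality F q →
                 ∀ (n : ℕ) → 2 ≤ n →
                 UpperTriangular.CliqueNumber≡ F n q
proposition4 F isField q card (suc n) _ =  -- only n ≥ 1 is needed
  scalar-clique isField card , λ k → clique-size≤ (IsField.1≉0 isField) card
  where open UnitaryCayleyClique F
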